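{- Let $\{a_n\}_{n\ge0}$ be a sequence of nonzero real numbers and set $u_n=\dfrac{a_{n-1}a_{n+1}}{a_n^2}$ for $n\ge1$. Suppose there exist an integer $N_1$ and real sequences $\{f_n\}$ (upper bound) and $\{g_n\}$ (lower bound) such that $0<g_n<u_n<f_n$ for all $n\ge N_1$, and an integer $N_2$ such that \[ g_{n-1}\,g_n^2\,g_{n+1}-4f_n+3>0 \quad\text{for all } n\ge N_2 . \] Let $N=\max\{N_1,N_2\}$. Then $\{a_n\}_{n\ge N}$ satisfies the Laguerre inequality of order two, i.e. $a_na_{n+4}-4a_{n+1}a_{n+3}+3a_{n+2}^2\ge0$ for all $n\ge N$.
   Context: A sequence $\{a_n\}$ satisfies the Laguerre inequality of order $m$ at $n$ if $L_m(a_n):=\frac12\sum_{k=0}^{2m}(-1)^{k+m}\binom{2m}{k}a_{n+k}a_{2m-k+n}\ge0$; for $m=2$ this equals $a_na_{n+4}-4a_{n+1}a_{n+3}+3a_{n+2}^2$. -}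

module Defs where

open import Level using (Level; suc; _⊔_)
open import Data.Nat as ℕ using (ℕ; _∸_)
open import Data.Product using (Σ; ∃; _×_; _,_)
open import Data.Sum using (_⊎_)
open import Relation.Binary.PropositionalEquality using (_≡_; _≢_)
open import Relation.Nullary using (¬_)
open import Algebra.Structures using (IsCommutativeRing)

-- We axiomatise them as a
-- (classical) Dedekind-complete ordered field, i.e. the usual axioms
-- characterising ℝ up to isomorphism.
record RealField (c ℓ : Level) : Set (Level.suc (c ⊔ ℓ)) where
  infixl 7 _*_
  infixl 6 _+_ _-_
  infix 4 _<_ _≤_
  field
    Carrier : Set c
    _+_ _*_ : Carrier → Carrier → Carrier
    -_      : Carrier → Carrier
    0# 1#   : Carrier
    isCommutativeRing : IsCommutativeRing _≡_ _+_ _*_ -_ 0# 1#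
    -- multiplicative inverse (value at 0 is irrelevant)
    inv     : Carrier → Carrier
    inv-ʳ   : ∀ x → x ≢ 0# → x * inv x ≡ 1#
    0≢1     : 0# ≢ 1#
    _<_     : Carrier → Carrier → Set ℓ
    <-irrefl : ∀ x → ¬ (x < x)
    <-trans  : ∀ {x y z} → x < y → y < z → x < z
    <-tri    : ∀ x y → x < y ⊎ (x ≡ y ⊎ y < x)
    +-mono-< : ∀ {x y} z → x < y → x + z < y + z
    *-pos    : ∀ {x y} → 0# < x → 0# < y → 0# < x * y
    sup      : (P : Carrier → Set ℓ) → (∃ λ x → P x) →
               (∃ λ b → ∀ x → P x → x < b ⊎ x ≡ b) →
               ∃ λ s → (∀ x → P x → x < s ⊎ x ≡ s) ×
                       (∀ b → (∀ x → P x → x < b ⊎ x ≡ b) → s < b ⊎ s ≡ b)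

  _≤_ : Carrier → Carrier → Set (c ⊔ ℓ)
  x ≤ y = x < y ⊎ x ≡ y

  _-_ : Carrier → Carrier → Carrier
  x - y = x + (- y)

  3# 4# : Carrier
  3# = 1# + 1# + 1#
  4# = 1# + 1# + 1# + 1#

  -- u n = a (n-1) a (n+1) / a n ^ 2   (meaningful for n ≥ 1)
  ratio : (ℕ → Carrier) → ℕ → Carrier
  ratio a n = a (n ∸ 1) * a (ℕ.suc n) * inv (a n * a n)

  L₂ : (ℕ → Carrier) → ℕ → Carrier
  L₂ a n = a n * a (n ℕ.+ 4) - 4# * a (n ℕ.+ 1) * a (n ℕ.+ 3)
           + 3# * (a (n ℕ.+ 2) * a (n ℕ.+ 2))

-- With u k = a (k-1) a (k+1) / a k ², the Laguerre expression factors as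
--   L₂ a n = (u (n+1) u (n+2)² u (n+3) - 4 u (n+2) + 3) · a (n+2)²,
-- because the telescoping product u (n+1) u (n+2)² u (n+3) equals
-- a n a (n+4) / a (n+2)².  For n ≥ max N₁ N₂ the bracket dominates
-- g (n+1) g (n+2)² g (n+3) - 4 f (n+2) + 3 > 0 (the g's bound the u's from
-- below, f (n+2) bounds u (n+2) from above), and a (n+2)² > 0.
module Submission where

open import Defs
open import Data.Nat as ℕ using (ℕ; suc; _∸_; _⊔_; s≤s; z≤n) renaming (_≤_ to _≤ℕ_)
import Data.Nat.Properties as ℕₚ
open import Data.Product using (_×_; _,_)
open import Data.Sum using (inj₁; inj₂)
open import Data.Empty using (⊥-elim)
open import Relation.Binary.PropositionalEquality
  using (_≡_; _≢_; refl; sym; trans; cong; cong₂; subst; subst₂; module ≡-Reasoning)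
open import Algebra.Bundles using (CommutativeRing)

module OrderedFieldProperties {c ℓ} (R : RealField c ℓ) where

  open RealField R renaming (+-mono-< to +-monoˡ-<)

  commutativeRing : CommutativeRing c c
  commutativeRing = record { isCommutativeRing = isCommutativeRing }

  open CommutativeRing commutativeRing
    using (+-assoc; +-comm; +-identityˡ; +-identityʳ; -‿inverseˡ; -‿inverseʳ;
           *-comm; *-assoc; *-identityˡ; distribʳ; ring)
  open import Algebra.Properties.Ring ring
    using (-‿distribˡ-*; -‿distribʳ-*; -‿involutive; x[y-z]≈xy-xz; [y-z]x≈yx-zx)

  x<y⇒0<y-x : ∀ {x y} → x < y → 0# < y - x
  x<y⇒0<y-x {x} {y} x<y = subst (_< y - x) (-‿inverseʳ x) (+-monoˡ-< (- x) x<y)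

  0<y-x⇒x<y : ∀ {x y} → 0# < y - x → x < y
  0<y-x⇒x<y {x} {y} 0<y-x = subst₂ _<_ (+-identityˡ x) y-x+x≡y (+-monoˡ-< x 0<y-x)
    where
    y-x+x≡y : y - x + x ≡ y
    y-x+x≡y = trans (+-assoc y (- x) x) (trans (cong (y +_) (-‿inverseˡ x)) (+-identityʳ y))

  +-monoʳ-< : ∀ {x y} z → x < y → z + x < z + y
  +-monoʳ-< {x} {y} z x<y = subst₂ _<_ (+-comm x z) (+-comm y z) (+-monoˡ-< z x<y)

  +-mono-< : ∀ {x y u v} → x < y → u < v → x + u < y + v
  +-mono-< {y = y} {u} x<y u<v = <-trans (+-monoˡ-< u x<y) (+-monoʳ-< y u<v)

  neg-mono-< : ∀ {x y} → x < y → - y < - x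
  neg-mono-< {x} {y} x<y = 0<y-x⇒x<y (subst (0# <_) y-x≡-x--y (x<y⇒0<y-x x<y))
    where
    y-x≡-x--y : y - x ≡ - x - - y
    y-x≡-x--y = trans (+-comm y (- x)) (cong (- x +_) (sym (-‿involutive y)))

  *-monoˡ-< : ∀ {x y} z → 0# < z → x < y → z * x < z * y
  *-monoˡ-< {x} {y} z 0<z x<y =
    0<y-x⇒x<y (subst (0# <_) (x[y-z]≈xy-xz z y x) (*-pos 0<z (x<y⇒0<y-x x<y)))

  *-monoʳ-< : ∀ {x y} z → 0# < z → x < y → x * z < y * z
  *-monoʳ-< {x} {y} z 0<z x<y = subst₂ _<_ (*-comm z x) (*-comm z y) (*-monoˡ-< z 0<z x<y)

  *-mono-< : ∀ {x y u v} → 0# < x → x < y → 0# < u → u < v → x * u < y * v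
  *-mono-< {x} {y} {u} 0<x x<y 0<u u<v =
    <-trans (*-monoʳ-< u 0<u x<y) (*-monoˡ-< y (<-trans 0<x x<y) u<v)

  x-qy+z-mono-< : ∀ {x x′ y y′} q z → 0# < q → x < x′ → y′ < y → x - q * y + z < x′ - q * y′ + z
  x-qy+z-mono-< q z 0<q x<x′ y′<y = +-monoˡ-< z (+-mono-< x<x′ (neg-mono-< (*-monoˡ-< q 0<q y′<y)))

  0<x⇒x≢0 : ∀ {x} → 0# < x → x ≢ 0#
  0<x⇒x≢0 0<x refl = <-irrefl 0# 0<x

  x≢0⇒0<x*x : ∀ {x} → x ≢ 0# → 0# < x * x
  x≢0⇒0<x*x {x} x≢0 with <-tri 0# x
  ... | inj₁ 0<x = *-pos 0<x 0<x
  ... | inj₂ (inj₁ 0≡x) = ⊥-elim (x≢0 (sym 0≡x))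
  ... | inj₂ (inj₂ x<0) = subst (0# <_) -x*-x≡x*x (*-pos 0<-x 0<-x)
    where
    0<-x : 0# < - x
    0<-x = subst₂ _<_ (-‿inverseʳ x) (+-identityˡ (- x)) (+-monoˡ-< (- x) x<0)
    -x*-x≡x*x : - x * - x ≡ x * x
    -x*-x≡x*x = trans (sym (-‿distribˡ-* x (- x)))
                  (trans (cong -_ (sym (-‿distribʳ-* x x))) (-‿involutive (x * x)))

  0<1 : 0# < 1#
  0<1 = subst (0# <_) (*-identityˡ 1#) (x≢0⇒0<x*x (λ 1≡0 → 0≢1 (sym 1≡0)))

  0<4 : 0# < 4#
  0<4 = +-pos (+-pos (+-pos 0<1 0<1) 0<1) 0<1
    where
    +-pos : ∀ {x y} → 0# < x → 0# < y → 0# < x + y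
    +-pos {x} {y} 0<x 0<y = <-trans 0<y (subst (_< x + y) (+-identityˡ y) (+-monoˡ-< y 0<x))

  x*y²*z-mono-< : ∀ {x x′ y y′ z z′} →
    0# < x → x < x′ → 0# < y → y < y′ → 0# < z → z < z′ →
    x * (y * y) * z < x′ * (y′ * y′) * z′
  x*y²*z-mono-< 0<x x<x′ 0<y y<y′ 0<z z<z′ =
    *-mono-< (*-pos 0<x (*-pos 0<y 0<y)) (*-mono-< 0<x x<x′ (*-pos 0<y 0<y) (*-mono-< 0<y y<y′ 0<y y<y′))
             0<z z<z′

  [x-qy+z]w≡xw-q[yw]+zw : ∀ x q y z w → (x - q * y + z) * w ≡ x * w - q * (y * w) + z * w
  [x-qy+z]w≡xw-q[yw]+zw x q y z w = begin
    (x - q * y + z) * w          ≡⟨ distribʳ w (x - q * y) z ⟩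
    (x - q * y) * w + z * w      ≡⟨ cong (_+ z * w) ([y-z]x≈yx-zx w x (q * y)) ⟩
    x * w - q * y * w + z * w    ≡⟨ cong (λ t → x * w - t + z * w) (*-assoc q y w) ⟩
    x * w - q * (y * w) + z * w  ∎
    where open ≡-Reasoning

  x*x*inv[x*x]≡1 : ∀ {x} → x ≢ 0# → x * x * inv (x * x) ≡ 1#
  x*x*inv[x*x]≡1 x≢0 = inv-ʳ _ (0<x⇒x≢0 (x≢0⇒0<x*x x≢0))

module LaguerreFactorisation {c ℓ} (R : RealField c ℓ) where

  open RealField R
  open OrderedFieldProperties R
  open CommutativeRing commutativeRing using (*-assoc; *-identityʳ; commutativeSemiring)
  open import Algebra.Solver.Ring.NaturalCoefficients.Default commutativeSemiring
  open ≡-Reasoning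

  ratio*square : ∀ (a : ℕ → Carrier) n → a n ≢ 0# → ratio a n * (a n * a n) ≡ a (n ∸ 1) * a (suc n)
  ratio*square a n aₙ≢0 = begin
    p * inv (a n * a n) * (a n * a n)  ≡⟨ solve 3 (λ p j w → p :* j :* w := p :* (w :* j)) refl p _ _ ⟩
    p * (a n * a n * inv (a n * a n))  ≡⟨ cong (p *_) (x*x*inv[x*x]≡1 aₙ≢0) ⟩
    p * 1#                             ≡⟨ *-identityʳ p ⟩
    p                                  ∎
    where p = a (n ∸ 1) * a (suc n)

  ratio-window : ∀ (a : ℕ → Carrier) n → a (1 ℕ.+ n) ≢ 0# → a (2 ℕ.+ n) ≢ 0# → a (3 ℕ.+ n) ≢ 0# →
    ratio a (1 ℕ.+ n) * (ratio a (2 ℕ.+ n) * ratio a (2 ℕ.+ n)) * ratio a (3 ℕ.+ n) * (a (2 ℕ.+ n) * a (2 ℕ.+ n))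
      ≡ a n * a (4 ℕ.+ n)
  ratio-window a n a₁≢0 a₂≢0 a₃≢0 = begin
    a₀ * a₂ * j₁ * ((a₁ * a₃ * j₂) * (a₁ * a₃ * j₂)) * (a₂ * a₄ * j₃) * (a₂ * a₂)
      ≡⟨ solve 8 (λ x₀ x₁ x₂ x₃ x₄ i₁ i₂ i₃ →
           x₀ :* x₂ :* i₁ :* ((x₁ :* x₃ :* i₂) :* (x₁ :* x₃ :* i₂)) :* (x₂ :* x₄ :* i₃) :* (x₂ :* x₂)
           := x₀ :* x₄ :* ((x₁ :* x₁ :* i₁) :* (x₃ :* x₃ :* i₃) :* ((x₂ :* x₂ :* i₂) :* (x₂ :* x₂ :* i₂))))
           refl a₀ a₁ a₂ a₃ a₄ j₁ j₂ j₃ ⟩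
    a₀ * a₄ * ((a₁ * a₁ * j₁) * (a₃ * a₃ * j₃) * ((a₂ * a₂ * j₂) * (a₂ * a₂ * j₂)))
      ≡⟨ cong (a₀ * a₄ *_) (cong₂ _*_ (cong₂ _*_ (x*x*inv[x*x]≡1 a₁≢0) (x*x*inv[x*x]≡1 a₃≢0))
                                      (cong₂ _*_ (x*x*inv[x*x]≡1 a₂≢0) (x*x*inv[x*x]≡1 a₂≢0))) ⟩
    a₀ * a₄ * (1# * 1# * (1# * 1#))
      ≡⟨ solve 1 (λ x → x :* (con 1 :* con 1 :* (con 1 :* con 1)) := x) refl (a₀ * a₄) ⟩
    a₀ * a₄ ∎
    where
    a₀ = a n
    a₁ = a (1 ℕ.+ n)
    a₂ = a (2 ℕ.+ n)
    a₃ = a (3 ℕ.+ n)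
    a₄ = a (4 ℕ.+ n)
    j₁ = inv (a₁ * a₁)
    j₂ = inv (a₂ * a₂)
    j₃ = inv (a₃ * a₃)

  L₂-indices-comm : ∀ (a : ℕ → Carrier) n →
    a n * a (4 ℕ.+ n) - 4# * a (1 ℕ.+ n) * a (3 ℕ.+ n) + 3# * (a (2 ℕ.+ n) * a (2 ℕ.+ n)) ≡ L₂ a n
  L₂-indices-comm a n
    rewrite ℕₚ.+-comm n 4 | ℕₚ.+-comm n 1 | ℕₚ.+-comm n 2 | ℕₚ.+-comm n 3 = refl

  laguerreBracket : (lower upper : ℕ → Carrier) → ℕ → Carrier
  laguerreBracket lower upper n =
    lower (1 ℕ.+ n) * (lower (2 ℕ.+ n) * lower (2 ℕ.+ n)) * lower (3 ℕ.+ n) - 4# * upper (2 ℕ.+ n) + 3#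

  L₂-factorisation : ∀ (a : ℕ → Carrier) n → a (1 ℕ.+ n) ≢ 0# → a (2 ℕ.+ n) ≢ 0# → a (3 ℕ.+ n) ≢ 0# →
    laguerreBracket (ratio a) (ratio a) n * (a (2 ℕ.+ n) * a (2 ℕ.+ n)) ≡ L₂ a n
  L₂-factorisation a n a₁≢0 a₂≢0 a₃≢0 = begin
    (U - 4# * u + 3#) * w
      ≡⟨ [x-qy+z]w≡xw-q[yw]+zw U 4# u 3# w ⟩
    U * w - 4# * (u * w) + 3# * w
      ≡⟨ cong₂ (λ p q → p - 4# * q + 3# * w) (ratio-window a n a₁≢0 a₂≢0 a₃≢0) (ratio*square a (2 ℕ.+ n) a₂≢0) ⟩
    a n * a (4 ℕ.+ n) - 4# * (a (1 ℕ.+ n) * a (3 ℕ.+ n)) + 3# * w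
      ≡⟨ cong (λ t → a n * a (4 ℕ.+ n) - t + 3# * w) (sym (*-assoc 4# (a (1 ℕ.+ n)) (a (3 ℕ.+ n)))) ⟩
    a n * a (4 ℕ.+ n) - 4# * a (1 ℕ.+ n) * a (3 ℕ.+ n) + 3# * w
      ≡⟨ L₂-indices-comm a n ⟩
    L₂ a n ∎
    where
    u = ratio a (2 ℕ.+ n)
    U = ratio a (1 ℕ.+ n) * (u * u) * ratio a (3 ℕ.+ n)
    w = a (2 ℕ.+ n) * a (2 ℕ.+ n)

theorem5p1 : ∀ {c ℓ} (R : RealField c ℓ) → let open RealField R in
    (a f g : ℕ → Carrier) (N₁ N₂ : ℕ) →
    (∀ n → a n ≢ 0#) →
    (∀ n → 1 ≤ℕ n → N₁ ≤ℕ n →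
      (0# < g n) × (g n < ratio a n) × (ratio a n < f n)) →
    (∀ n → 1 ≤ℕ n → N₂ ≤ℕ n →
      0# < g (n ∸ 1) * (g n * g n) * g (suc n) - 4# * f n + 3#) →
    ∀ n → N₁ ⊔ N₂ ≤ℕ n → 0# ≤ L₂ a n
theorem5p1 R a f g N₁ N₂ a≢0 bounds margin n N≤n =
  inj₁ (subst (0# <_) (L₂-factorisation a n (a≢0 _) (a≢0 _) (a≢0 _))
    (*-pos (<-trans margin₂ bracket-mono) (x≢0⇒0<x*x (a≢0 _))))
  where
  open RealField R
  open OrderedFieldProperties R
  open LaguerreFactorisation R

  boundsAt : ∀ k → let m = suc k ℕ.+ n in (0# < g m) × (g m < ratio a m) × (ratio a m < f m)
  boundsAt k = bounds _ (s≤s z≤n) (ℕₚ.m≤n⇒m≤o+n (suc k) (ℕₚ.≤-trans (ℕₚ.m≤m⊔n N₁ N₂) N≤n))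

  margin₂ : 0# < laguerreBracket g f n
  margin₂ = margin (2 ℕ.+ n) (s≤s z≤n) (ℕₚ.m≤n⇒m≤o+n 2 (ℕₚ.≤-trans (ℕₚ.m≤n⊔m N₁ N₂) N≤n))

  bracket-mono : laguerreBracket g f n < laguerreBracket (ratio a) (ratio a) n
  bracket-mono = let (0<g₁ , g₁<u₁ , _) = boundsAt 0
                     (0<g₂ , g₂<u₂ , u₂<f₂) = boundsAt 1
                     (0<g₃ , g₃<u₃ , _) = boundsAt 2
                 in x-qy+z-mono-< 4# 3# 0<4 (x*y²*z-mono-< 0<g₁ g₁<u₁ 0<g₂ g₂<u₂ 0<g₃ g₃<u₃) u₂<f₂
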